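{- Let $n\ge 2$, $d\ge 0$, and let $C$ be an $n\times n$ circulant matrix with generator $(c_0,\ldots,c_{n-1})$ such that $c_0=d$, $c_j\in\{1,-1\}$ for $j=1,\ldots,n-1$, and $CC^T=(d^2+n-1)I$. If $n-1$ is a prime number, then $d=\frac{n}{2}-1$.
   Context: A circulant matrix of order $n$ with generator $(c_0,c_1,\ldots,c_{n-1})$ is the $n\times n$ matrix whose entry in row $i$ and column $j$ (indices $0,\ldots,n-1$) is $c_{(j-i)\bmod n}$.
   Formalization: The parameter d ranges over the nonnegative rationals, so the generator and the entries of the circulant matrix C are rational. -}

module Defs where

open import Data.Nat using (ℕ; zero; suc; _+_; _∸_)
open import Data.Nat.DivMod using (_mod_)
open import Data.Fin using (Fin; toℕ) renaming (zero to fzero; suc to fsuc)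
open import Data.Fin.Properties using () renaming (_≟_ to _≟ᶠ_)
open import Data.Integer using (+_)
open import Data.Rational using (ℚ; 0ℚ; 1ℚ; _/_) renaming (_+_ to _+ℚ_; _*_ to _*ℚ_)
open import Relation.Nullary using (yes; no)

Matrix : ℕ → Set
Matrix n = Fin n → Fin n → ℚ

ℕ→ℚ : ℕ → ℚ
ℕ→ℚ k = + k / 1

Σ : ∀ {n} → (Fin n → ℚ) → ℚ
Σ {zero}  f = 0ℚ
Σ {suc n} f = f fzero +ℚ Σ {n} (λ k → f (fsuc k))

diffMod : ∀ {n} → Fin n → Fin n → Fin n
diffMod {suc m} i j = (suc m + toℕ j ∸ toℕ i) mod (suc m)

-- circulant matrix with generator c : entry (i , j) is c ((j - i) mod n)
circulant : ∀ {n} → (Fin n → ℚ) → Matrix n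
circulant c i j = c (diffMod i j)

transpose : ∀ {n} → Matrix n → Matrix n
transpose A i j = A j i

_·_ : ∀ {n} → Matrix n → Matrix n → Matrix n
(A · B) i j = Σ (λ k → A i k *ℚ B k j)

identity : ∀ {n} → Matrix n
identity i j with i ≟ᶠ j
... | yes _ = 1ℚ
... | no  _ = 0ℚ

scale : ∀ {n} → ℚ → Matrix n → Matrix n
scale a A i j = a *ℚ A i j

module Submission where

-- Let C be the circulant matrix of c = (d, c₁, …, c_{n-1}) with cⱼ = ±1 for j ≠ 0,
-- C Cᵀ = x I where x = d² + p, p = n - 1 prime.  Write T = Σ c = d + S, S = Σ_{j≠0} cⱼ.
--
-- 1. Summing the first row of C Cᵀ gives T² = x (every column of C contains each
--    cₖ once), i.e. (2d)·S + S² = p.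
-- 2. 2d is an integer.  If c_s + c_{-s} = 0 for all s ≠ 0, the non-central entries
--    cancel in pairs, so T = d and d² = d² + p, impossible.  Otherwise pick s ≠ 0
--    with c_s = c_{-s} = ε; the vanishing entry (0,s) of C Cᵀ reads 2εd + R = 0
--    with R a sum of products of ±1's, so 2d = -εR is an integer.
-- 3. With a = 2d ∈ ℕ and S ∈ ℤ, (a + S)·S = p forces S = 1 or S = -p, and in
--    both cases a = p - 1, i.e. d = n/2 - 1.

open import Defs
open import Data.Nat using (ℕ; _≤_; _∸_)
open import Data.Nat.Primality using (Prime)
open import Data.Fin using (Fin; toℕ)
open import Data.Integer using (+_)
open import Data.Rational using (ℚ; 0ℚ; 1ℚ; -_; _/_; _+_; _*_; _-_) renaming (_≤_ to _≤ℚ_)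
open import Data.Sum using (_⊎_)
open import Relation.Binary.PropositionalEquality using (_≡_; _≢_)

open import Algebra.Bundles using (CommutativeRing)
open import Data.Empty using (⊥-elim)
open import Data.Fin using (punchIn) renaming (zero to fzero; suc to fsuc)
import Data.Fin.Properties as FinP
open import Data.Fin.Permutation using (permutation)
open import Data.Integer as ℤ using (ℤ; -[1+_])
import Data.Integer.Properties as ℤP
import Data.Integer.Tactic.RingSolver as ℤ-Solver
open import Data.Nat as ℕ using (zero; suc; s≤s; z≤n)
open import Data.Nat.Base using (nonTrivial⇒n>1)
open import Data.Nat.Divisibility using (_∣_; n∣m*n; ∣m+n∣m⇒∣n)
open import Data.Nat.DivMod using (_%_; [m+n]%n≡m%n; m<n⇒m%n≡m)
open import Data.Nat.Primality using (prime⇒irreducible; prime⇒nonTrivial; prime⇒nonZero)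
import Data.Nat.Properties as ℕP
open import Data.Product using (∃-syntax; _,_; uncurry)
open import Data.Rational using (↥_; *≤*)
open import Data.Rational.Literals using (fromℤ)
import Data.Rational.Properties as ℚP
open import Data.Rational.Unnormalised.Properties using () renaming (≃-trans to ≃ᵘ-trans; ≃-sym to ≃ᵘ-sym)
import Data.Rational.Unnormalised as ℚᵘ
open import Data.Sum using (inj₁; inj₂)
open import Data.Vec.Functional using (removeAt)
open import Function using (_∘_)
open import Level using (0ℓ)
open import Relation.Binary.PropositionalEquality using (refl; sym; trans; cong; cong₂; subst; module ≡-Reasoning)
open import Relation.Nullary using (Dec; yes; no)
open import Relation.Nullary.Decidable using (dec⇒maybe)
open import Tactic.RingSolver using (solve-∀)
open import Tactic.RingSolver.Core.AlmostCommutativeRing using (AlmostCommutativeRing; fromCommutativeRing)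

open import Algebra.Properties.Semiring.Sum (CommutativeRing.semiring ℚP.+-*-commutativeRing)
  using (sum; sum-cong-≗; ∑-comm; ∑-distrib-+; sum-remove; sum-permute; sum-replicate-zero; *-distribˡ-sum; *-distribʳ-sum)

ℚ-ring : AlmostCommutativeRing 0ℓ 0ℓ
ℚ-ring = fromCommutativeRing ℚP.+-*-commutativeRing (λ x → dec⇒maybe (0ℚ ℚP.≟ x))

double-injective : ∀ {x y : ℚ} → x + x ≡ y + y → x ≡ y
double-injective {x} {y} eq = begin
  x                     ≡⟨ halve x ⟩
  (+ 1 / 2) * (x + x)   ≡⟨ cong ((+ 1 / 2) *_) eq ⟩
  (+ 1 / 2) * (y + y)   ≡⟨ sym (halve y) ⟩
  y                     ∎
  where
  open ≡-Reasoning
  halve : ∀ z → z ≡ (+ 1 / 2) * (z + z)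
  halve = solve-∀ ℚ-ring

Σ≡sum : ∀ {n} (f : Fin n → ℚ) → Σ f ≡ sum f
Σ≡sum {zero}  f = refl
Σ≡sum {suc n} f = cong (λ t → f fzero + t) (Σ≡sum (f ∘ fsuc))

sum-involution : ∀ {n} (σ : Fin n → Fin n) → (∀ k → σ (σ k) ≡ k) →
                 (f : Fin n → ℚ) → sum (f ∘ σ) ≡ sum f
sum-involution σ σσ≡id f = sym (sum-permute f (permutation σ σ σσ≡id σσ≡id))

module _ {m : ℕ} where

  private
    n : ℕ
    n = suc m

  toℕ-diffMod-≤ : (s k : Fin n) → toℕ s ℕ.≤ toℕ k → toℕ (diffMod s k) ≡ toℕ k ∸ toℕ s
  toℕ-diffMod-≤ s k s≤k = begin
    toℕ (diffMod s k)              ≡⟨ FinP.toℕ-fromℕ< _ ⟩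
    (n ℕ.+ toℕ k ∸ toℕ s) % n      ≡⟨ cong (_% n) (ℕP.+-∸-assoc n s≤k) ⟩
    (n ℕ.+ (toℕ k ∸ toℕ s)) % n    ≡⟨ cong (_% n) (ℕP.+-comm n _) ⟩
    (toℕ k ∸ toℕ s ℕ.+ n) % n      ≡⟨ [m+n]%n≡m%n (toℕ k ∸ toℕ s) n ⟩
    (toℕ k ∸ toℕ s) % n            ≡⟨ m<n⇒m%n≡m (ℕP.≤-<-trans (ℕP.m∸n≤m (toℕ k) (toℕ s)) (FinP.toℕ<n k)) ⟩
    toℕ k ∸ toℕ s                  ∎
    where open ≡-Reasoning

  toℕ-diffMod-> : (s k : Fin n) → toℕ k ℕ.< toℕ s → toℕ (diffMod s k) ≡ (n ∸ toℕ s) ℕ.+ toℕ k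
  toℕ-diffMod-> s k k<s = begin
    toℕ (diffMod s k)              ≡⟨ FinP.toℕ-fromℕ< _ ⟩
    (n ℕ.+ toℕ k ∸ toℕ s) % n      ≡⟨ cong (_% n) (ℕP.+-∸-comm (toℕ k) s≤n) ⟩
    ((n ∸ toℕ s) ℕ.+ toℕ k) % n    ≡⟨ m<n⇒m%n≡m below-n ⟩
    (n ∸ toℕ s) ℕ.+ toℕ k          ∎
    where
    open ≡-Reasoning
    s≤n : toℕ s ℕ.≤ n
    s≤n = ℕP.<⇒≤ (FinP.toℕ<n s)
    below-n : (n ∸ toℕ s) ℕ.+ toℕ k ℕ.< n
    below-n = subst ((n ∸ toℕ s) ℕ.+ toℕ k ℕ.<_) (ℕP.m∸n+n≡m s≤n)
                (ℕP.+-monoʳ-< (n ∸ toℕ s) k<s)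

  diffMod-zeroˡ : (k : Fin n) → diffMod fzero k ≡ k
  diffMod-zeroˡ k = FinP.toℕ-injective (toℕ-diffMod-≤ fzero k z≤n)

  diffMod-self : (k : Fin n) → diffMod k k ≡ fzero
  diffMod-self k = FinP.toℕ-injective (trans (toℕ-diffMod-≤ k k ℕP.≤-refl) (ℕP.n∸n≡0 (toℕ k)))

  diffMod-involutive : (j k : Fin n) → diffMod (diffMod j k) k ≡ j
  diffMod-involutive j k with toℕ j ℕ.≤? toℕ k
  ... | yes j≤k = FinP.toℕ-injective (begin
    toℕ (diffMod (diffMod j k) k)   ≡⟨ toℕ-diffMod-≤ (diffMod j k) k k-j≤k ⟩
    toℕ k ∸ toℕ (diffMod j k)       ≡⟨ cong (toℕ k ∸_) (toℕ-diffMod-≤ j k j≤k) ⟩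
    toℕ k ∸ (toℕ k ∸ toℕ j)         ≡⟨ ℕP.m∸[m∸n]≡n j≤k ⟩
    toℕ j                           ∎)
    where
    open ≡-Reasoning
    k-j≤k : toℕ (diffMod j k) ℕ.≤ toℕ k
    k-j≤k = subst (ℕ._≤ toℕ k) (sym (toℕ-diffMod-≤ j k j≤k)) (ℕP.m∸n≤m (toℕ k) (toℕ j))
  ... | no j≰k = FinP.toℕ-injective (begin
    toℕ (diffMod (diffMod j k) k)          ≡⟨ toℕ-diffMod-> (diffMod j k) k k<k-j ⟩
    (n ∸ toℕ (diffMod j k)) ℕ.+ toℕ k      ≡⟨ sym (ℕP.+-∸-comm (toℕ k) k-j≤n) ⟩
    n ℕ.+ toℕ k ∸ toℕ (diffMod j k)        ≡⟨ cong (n ℕ.+ toℕ k ∸_) k-j≡ ⟩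
    n ℕ.+ toℕ k ∸ (n ℕ.+ toℕ k ∸ toℕ j)    ≡⟨ ℕP.m∸[m∸n]≡n j≤n+k ⟩
    toℕ j                                  ∎)
    where
    open ≡-Reasoning
    j≤n : toℕ j ℕ.≤ n
    j≤n = ℕP.<⇒≤ (FinP.toℕ<n j)
    j≤n+k : toℕ j ℕ.≤ n ℕ.+ toℕ k
    j≤n+k = ℕP.≤-trans j≤n (ℕP.m≤m+n n (toℕ k))
    k-j≡ : toℕ (diffMod j k) ≡ n ℕ.+ toℕ k ∸ toℕ j
    k-j≡ = trans (toℕ-diffMod-> j k (ℕP.≰⇒> j≰k)) (sym (ℕP.+-∸-comm (toℕ k) j≤n))
    k<k-j : toℕ k ℕ.< toℕ (diffMod j k)
    k<k-j = subst (toℕ k ℕ.<_) (sym (toℕ-diffMod-> j k (ℕP.≰⇒> j≰k)))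
              (ℕP.m<n+m (toℕ k) (ℕP.m<n⇒0<n∸m (FinP.toℕ<n j)))
    k-j≤n : toℕ (diffMod j k) ℕ.≤ n
    k-j≤n = ℕP.<⇒≤ (FinP.toℕ<n (diffMod j k))

  diffMod≡0 : (j k : Fin n) → diffMod j k ≡ fzero → k ≡ j
  diffMod≡0 j k k-j≡0 = begin
    k                           ≡⟨ sym (diffMod-zeroˡ k) ⟩
    diffMod fzero k             ≡⟨ cong (λ i → diffMod i k) (sym k-j≡0) ⟩
    diffMod (diffMod j k) k     ≡⟨ diffMod-involutive j k ⟩
    j                           ∎
    where open ≡-Reasoning

  opposite : Fin n → Fin n
  opposite k = diffMod k fzero

  opposite-involutive : (k : Fin n) → opposite (opposite k) ≡ k
  opposite-involutive k = diffMod-involutive k fzero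

fromℤ-+ : ∀ a b → fromℤ (a ℤ.+ b) ≡ fromℤ a + fromℤ b
fromℤ-+ a b = ℚP.toℚᵘ-injective
  (≃ᵘ-trans (ℚᵘ.*≡* (over-1 a b)) (≃ᵘ-sym (ℚP.toℚᵘ-homo-+ (fromℤ a) (fromℤ b))))
  where
  over-1 : ∀ a b → (a ℤ.+ b) ℤ.* + 1 ≡ (a ℤ.* + 1 ℤ.+ b ℤ.* + 1) ℤ.* + 1
  over-1 = ℤ-Solver.solve-∀

fromℤ-* : ∀ a b → fromℤ (a ℤ.* b) ≡ fromℤ a * fromℤ b
fromℤ-* a b = ℚP.toℚᵘ-injective
  (≃ᵘ-trans (ℚᵘ.*≡* refl) (≃ᵘ-sym (ℚP.toℚᵘ-homo-* (fromℤ a) (fromℤ b))))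

fromℤ-injective : ∀ {a b} → fromℤ a ≡ fromℤ b → a ≡ b
fromℤ-injective = cong ↥_

ℕ→ℚ≡fromℤ : ∀ k → ℕ→ℚ k ≡ fromℤ (+ k)
ℕ→ℚ≡fromℤ k = ℚP.normalize-coprime _

IsInt : ℚ → Set
IsInt q = ∃[ z ] fromℤ z ≡ q

int-+ : ∀ {p q} → IsInt p → IsInt q → IsInt (p + q)
int-+ (a , refl) (b , refl) = a ℤ.+ b , fromℤ-+ a b

int-* : ∀ {p q} → IsInt p → IsInt q → IsInt (p * q)
int-* (a , refl) (b , refl) = a ℤ.* b , fromℤ-* a b

sum-int : ∀ {n} (f : Fin n → ℚ) → (∀ k → IsInt (f k)) → IsInt (sum f)
sum-int {zero}  f _     = + 0 , refl
sum-int {suc n} f f-int = int-+ (f-int fzero) (sum-int (f ∘ fsuc) (f-int ∘ fsuc))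

nonneg-int : ∀ {q} → IsInt q → 0ℚ ≤ℚ q → ∃[ a ] fromℤ (+ a) ≡ q
nonneg-int (+ a      , eq) _ = a , eq
nonneg-int (-[1+ a ] , refl) (*≤* ())

IsSign : ℚ → Set
IsSign q = q ≡ 1ℚ ⊎ q ≡ - 1ℚ

sign-int : ∀ {q} → IsSign q → IsInt q
sign-int (inj₁ refl) = + 1 , refl
sign-int (inj₂ refl) = -[1+ 0 ] , refl

sign-square : ∀ {q} → IsSign q → q * q ≡ 1ℚ
sign-square (inj₁ refl) = refl
sign-square (inj₂ refl) = refl

signs-agree : ∀ {p q} → IsSign p → IsSign q → p + q ≢ 0ℚ → q ≡ p
signs-agree (inj₁ refl) (inj₁ refl) _     = refl
signs-agree (inj₂ refl) (inj₂ refl) _     = refl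
signs-agree (inj₁ refl) (inj₂ refl) p+q≢0 = ⊥-elim (p+q≢0 refl)
signs-agree (inj₂ refl) (inj₁ refl) p+q≢0 = ⊥-elim (p+q≢0 refl)

solve-for-double : ∀ {ε y R} → IsSign ε → (ε + ε) * y + R ≡ 0ℚ → y + y ≡ ((- 1ℚ) * ε) * R
solve-for-double {ε} {y} {R} sign eq = begin
  y + y                                     ≡⟨ sym (ℚP.*-identityʳ (y + y)) ⟩
  (y + y) * 1ℚ                              ≡⟨ cong ((y + y) *_) (sym (sign-square sign)) ⟩
  (y + y) * (ε * ε)                         ≡⟨ expand ε y R ⟩
  ε * ((ε + ε) * y + R) + ((- 1ℚ) * ε) * R  ≡⟨ cong (λ t → ε * t + ((- 1ℚ) * ε) * R) eq ⟩
  ε * 0ℚ + ((- 1ℚ) * ε) * R                 ≡⟨ drop-zero ε (((- 1ℚ) * ε) * R) ⟩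
  ((- 1ℚ) * ε) * R                          ∎
  where
  open ≡-Reasoning
  expand : ∀ ε y R → (y + y) * (ε * ε) ≡ ε * ((ε + ε) * y + R) + ((- 1ℚ) * ε) * R
  expand = solve-∀ ℚ-ring
  drop-zero : ∀ ε z → ε * 0ℚ + z ≡ z
  drop-zero = solve-∀ ℚ-ring

gram : ∀ {n} → (Fin n → ℚ) → Matrix n
gram c = circulant c · transpose (circulant c)

GramScalar : ∀ {n} → (Fin n → ℚ) → ℚ → Set
GramScalar c x = ∀ i j → gram c i j ≡ scale x identity i j

module _ {m : ℕ} where

  private
    n : ℕ
    n = suc m

  gram-entry : (c : Fin n → ℚ) (i j : Fin n) →
               gram c i j ≡ sum (λ k → c (diffMod i k) * c (diffMod j k))
  gram-entry c i j = Σ≡sum (λ k → c (diffMod i k) * c (diffMod j k))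

  -- The first row of C Cᵀ sums to (Σ c)²: column k of C contains every entry of c once.
  gram-row-sum : (c : Fin n → ℚ) → sum (gram c fzero) ≡ sum c * sum c
  gram-row-sum c = begin
    sum (gram c fzero)
      ≡⟨ sum-cong-≗ (gram-entry c fzero) ⟩
    sum (λ j → sum (λ k → c (diffMod fzero k) * c (diffMod j k)))
      ≡⟨ ∑-comm (λ j k → c (diffMod fzero k) * c (diffMod j k)) ⟩
    sum (λ k → sum (λ j → c (diffMod fzero k) * c (diffMod j k)))
      ≡⟨ sum-cong-≗ (λ k → sym (*-distribˡ-sum (c (diffMod fzero k)) (λ j → c (diffMod j k)))) ⟩
    sum (λ k → c (diffMod fzero k) * sum (λ j → c (diffMod j k)))
      ≡⟨ sum-cong-≗ (λ k → cong₂ _*_ (cong c (diffMod-zeroˡ k))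
                                      (sum-involution (λ j → diffMod j k) (λ j → diffMod-involutive j k) c)) ⟩
    sum (λ k → c k * sum c)
      ≡⟨ sym (*-distribʳ-sum (sum c) c) ⟩
    sum c * sum c
      ∎
    where open ≡-Reasoning

  scalar-row-sum : (x : ℚ) → sum (scale {n} x identity fzero) ≡ x
  scalar-row-sum x = begin
    x * 1ℚ + sum (λ (_ : Fin m) → x * 0ℚ)   ≡⟨ cong₂ _+_ (ℚP.*-identityʳ x) (sum-cong-≗ {m} {λ _ → x * 0ℚ} {λ _ → 0ℚ} (λ _ → ℚP.*-zeroʳ x)) ⟩
    x + sum (λ (_ : Fin m) → 0ℚ)            ≡⟨ cong (λ t → x + t) (sum-replicate-zero m) ⟩
    x + 0ℚ                                  ≡⟨ ℚP.+-identityʳ x ⟩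
    x                                       ∎
    where open ≡-Reasoning

  generator-sum-squared : (c : Fin n → ℚ) (x : ℚ) → GramScalar c x → sum c * sum c ≡ x
  generator-sum-squared c x C·Cᵀ≡xI = begin
    sum c * sum c                   ≡⟨ sym (gram-row-sum c) ⟩
    sum (gram c fzero)              ≡⟨ sum-cong-≗ (C·Cᵀ≡xI fzero) ⟩
    sum (scale {n} x identity fzero) ≡⟨ scalar-row-sum x ⟩
    x                               ∎
    where open ≡-Reasoning

  antisymmetric-sum : (c : Fin n → ℚ) → (∀ k → c (fsuc k) + c (opposite (fsuc k)) ≡ 0ℚ) →
                      sum c ≡ c fzero
  antisymmetric-sum c antisym = double-injective (begin
    sum c + sum c
      ≡⟨ cong (λ t → sum c + t) (sym (sum-involution opposite opposite-involutive c)) ⟩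
    sum c + sum (c ∘ opposite)
      ≡⟨ sym (∑-distrib-+ c (c ∘ opposite)) ⟩
    (c fzero + c (opposite fzero)) + sum (λ k → c (fsuc k) + c (opposite (fsuc k)))
      ≡⟨ cong₂ _+_ (cong (λ i → c fzero + c i) (diffMod-self fzero))
                   (trans (sum-cong-≗ antisym) (sum-replicate-zero m)) ⟩
    (c fzero + c fzero) + 0ℚ
      ≡⟨ ℚP.+-identityʳ _ ⟩
    c fzero + c fzero
      ∎)
    where open ≡-Reasoning

-- From here on the order is at least 2, so that a non-central index exists.
module _ {m : ℕ} where

  private
    n : ℕ
    n = suc (suc m)

  -- The terms Σ_{k ∉ {0,s}} c_k c_{k-s} of entry (0,s) of C Cᵀ, for s ≠ 0.
  remainder : (c : Fin n → ℚ) (s : Fin (suc m)) → ℚ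
  remainder c s = sum (removeAt (λ k → c (diffMod fzero (fsuc k)) * c (diffMod (fsuc s) (fsuc k))) s)

  off-diagonal-entry : (c : Fin n → ℚ) (s : Fin (suc m)) →
    gram c fzero (fsuc s) ≡ (c (fsuc s) + c (opposite (fsuc s))) * c fzero + remainder c s
  off-diagonal-entry c s = begin
    gram c fzero (fsuc s)
      ≡⟨ gram-entry c fzero (fsuc s) ⟩
    term fzero + sum (term ∘ fsuc)
      ≡⟨ cong (λ t → term fzero + t) (sum-remove {i = s} (term ∘ fsuc)) ⟩
    term fzero + (term (fsuc s) + R)
      ≡⟨ cong₂ (λ u v → u + (v + R)) term-0 term-s ⟩
    c fzero * c (opposite (fsuc s)) + (c (fsuc s) * c fzero + R)
      ≡⟨ collect (c fzero) (c (fsuc s)) (c (opposite (fsuc s))) R ⟩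
    (c (fsuc s) + c (opposite (fsuc s))) * c fzero + R
      ∎
    where
    open ≡-Reasoning
    term : Fin n → ℚ
    term k = c (diffMod fzero k) * c (diffMod (fsuc s) k)
    R : ℚ
    R = remainder c s
    term-0 : term fzero ≡ c fzero * c (opposite (fsuc s))
    term-0 = cong (λ i → c i * c (opposite (fsuc s))) (diffMod-zeroˡ fzero)
    term-s : term (fsuc s) ≡ c (fsuc s) * c fzero
    term-s = cong₂ (λ i j → c i * c j) (diffMod-zeroˡ (fsuc s)) (diffMod-self (fsuc s))
    collect : ∀ c₀ a b R → c₀ * b + (a * c₀ + R) ≡ (a + b) * c₀ + R
    collect = solve-∀ ℚ-ring

  -- The remainder only involves non-central entries, so it is an integer when those are:
  -- its k-th term has indices k' = suc (punchIn s k) ≠ 0 and k' - (s + 1) ≠ 0.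
  remainder-int : (c : Fin n → ℚ) → (∀ j → j ≢ fzero → IsInt (c j)) → (s : Fin (suc m)) →
                  IsInt (remainder c s)
  remainder-int c c-int s = sum-int _ λ k → int-*
    (subst (IsInt ∘ c) (sym (diffMod-zeroˡ (fsuc (punchIn s k)))) (c-int _ λ ()))
    (c-int _ λ k-s≡0 → FinP.punchInᵢ≢i s k
      (FinP.suc-injective (diffMod≡0 (fsuc s) (fsuc (punchIn s k)) k-s≡0)))

  symmetric-pair-int : (c : Fin n → ℚ) (x : ℚ) → (∀ j → j ≢ fzero → IsSign (c j)) →
                       GramScalar c x → (s : Fin (suc m)) →
                       c (fsuc s) + c (opposite (fsuc s)) ≢ 0ℚ → IsInt (c fzero + c fzero)
  symmetric-pair-int c x signs C·Cᵀ≡xI s pair≢0 =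
    subst IsInt (sym (solve-for-double sign-cₛ entry≡0))
      (int-* (int-* (sign-int (inj₂ refl)) (sign-int sign-cₛ))
             (remainder-int c (λ j j≢0 → sign-int (signs j j≢0)) s))
    where
    open ≡-Reasoning
    sign-cₛ : IsSign (c (fsuc s))
    sign-cₛ = signs (fsuc s) λ ()
    opposite≢0 : opposite (fsuc s) ≢ fzero
    opposite≢0 eq = FinP.0≢1+n (diffMod≡0 (fsuc s) fzero eq)
    opposite-equal : c (opposite (fsuc s)) ≡ c (fsuc s)
    opposite-equal = signs-agree sign-cₛ (signs _ opposite≢0) pair≢0
    entry≡0 : (c (fsuc s) + c (fsuc s)) * c fzero + remainder c s ≡ 0ℚ
    entry≡0 = begin
      (c (fsuc s) + c (fsuc s)) * c fzero + remainder c s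
        ≡⟨ cong (λ t → (c (fsuc s) + t) * c fzero + remainder c s) (sym opposite-equal) ⟩
      (c (fsuc s) + c (opposite (fsuc s))) * c fzero + remainder c s
        ≡⟨ sym (off-diagonal-entry c s) ⟩
      gram c fzero (fsuc s)
        ≡⟨ C·Cᵀ≡xI fzero (fsuc s) ⟩
      x * 0ℚ
        ≡⟨ ℚP.*-zeroʳ x ⟩
      0ℚ
        ∎

  cancels? : (c : Fin n → ℚ) (k : Fin (suc m)) → Dec (c (fsuc k) + c (opposite (fsuc k)) ≡ 0ℚ)
  cancels? c k = c (fsuc k) + c (opposite (fsuc k)) ℚP.≟ 0ℚ

  twice-centre-int : (c : Fin n → ℚ) (x : ℚ) → (∀ j → j ≢ fzero → IsSign (c j)) →
                     GramScalar c x → x ≢ c fzero * c fzero → IsInt (c fzero + c fzero)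
  twice-centre-int c x signs C·Cᵀ≡xI x≢c₀² with FinP.all? (cancels? c)
  ... | yes antisym = ⊥-elim (x≢c₀² (begin
    x                    ≡⟨ sym (generator-sum-squared c x C·Cᵀ≡xI) ⟩
    sum c * sum c        ≡⟨ cong (λ t → t * t) (antisymmetric-sum c antisym) ⟩
    c fzero * c fzero    ∎))
    where open ≡-Reasoning
  ... | no ¬antisym = uncurry (symmetric-pair-int c x signs C·Cᵀ≡xI)
                        (FinP.¬∀⟶∃¬ (suc m) _ (cancels? c) ¬antisym)

prime>1 : ∀ {p} → Prime p → 1 ℕ.< p
prime>1 {p} p-prime = nonTrivial⇒n>1 p {{prime⇒nonTrivial p-prime}}

-- (a + x) x = p with p prime forces x = 1, hence a = p - 1 (x = p would give a + p = 1).
positive-root : ∀ {p} → Prime p → ∀ a x → (a ℕ.+ x) ℕ.* x ≡ p → a ≡ p ∸ 1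
positive-root {p} p-prime a x eq with prime⇒irreducible p-prime (subst (x ∣_) eq (n∣m*n (a ℕ.+ x)))
... | inj₁ refl = trans (sym (ℕP.m+n∸n≡m a 1)) (cong (_∸ 1) (trans (sym (ℕP.*-identityʳ (a ℕ.+ 1))) eq))
... | inj₂ refl = ⊥-elim (ℕP.<⇒≱ (prime>1 p-prime) (subst (p ℕ.≤_) a+p≡1 (ℕP.m≤n+m p a)))
  where
  a+p≡1 : a ℕ.+ p ≡ 1
  a+p≡1 = ℕP.*-cancelʳ-≡ (a ℕ.+ p) 1 p {{prime⇒nonZero p-prime}} (trans eq (sym (ℕP.*-identityˡ p)))

-- x² = p + a x with p prime forces x = p (x = 1 would give p + a = 1), hence a = p - 1.
negative-root : ∀ {p} → Prime p → ∀ a x → x ℕ.* x ≡ p ℕ.+ a ℕ.* x → a ≡ p ∸ 1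
negative-root {p} p-prime a x eq with prime⇒irreducible p-prime x∣p
  where
  x∣p : x ∣ p
  x∣p = ∣m+n∣m⇒∣n (subst (x ∣_) (trans eq (ℕP.+-comm p (a ℕ.* x))) (n∣m*n x)) (n∣m*n a)
... | inj₁ refl = ⊥-elim (ℕP.<⇒≱ (prime>1 p-prime) (subst (p ℕ.≤_) (sym eq) (ℕP.m≤m+n p (a ℕ.* 1))))
... | inj₂ refl = cong (_∸ 1) (sym p≡1+a)
  where
  p≡1+a : p ≡ suc a
  p≡1+a = ℕP.*-cancelʳ-≡ p (suc a) p {{prime⇒nonZero p-prime}} eq

root-lemma : ∀ {p} → Prime p → ∀ a (S : ℤ) → (+ a ℤ.+ S) ℤ.* S ≡ + p → a ≡ p ∸ 1
root-lemma p-prime a (+ x) eq =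
  positive-root p-prime a x (ℤP.+-injective (trans (ℤP.pos-* (a ℕ.+ x) x) eq))
root-lemma {p} p-prime a -[1+ y ] eq = negative-root p-prime a (suc y) (ℤP.+-injective (begin
  + (suc y ℕ.* suc y)                                  ≡⟨ ℤP.pos-* (suc y) (suc y) ⟩
  + suc y ℤ.* + suc y                                  ≡⟨ complete-square (+ a) (+ suc y) ⟩
  (+ a ℤ.+ -[1+ y ]) ℤ.* -[1+ y ] ℤ.+ + a ℤ.* + suc y  ≡⟨ cong₂ ℤ._+_ eq (sym (ℤP.pos-* a (suc y))) ⟩
  + (p ℕ.+ a ℕ.* suc y)                                ∎))
  where
  open ≡-Reasoning
  complete-square : ∀ A X → X ℤ.* X ≡ (A ℤ.+ ℤ.- X) ℤ.* (ℤ.- X) ℤ.+ A ℤ.* X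
  complete-square = ℤ-Solver.solve-∀

shift-≢ : ∀ (y : ℚ) k → y + ℕ→ℚ (suc k) ≢ y
shift-≢ y k eq = ℕP.1+n≢0 (ℤP.+-injective (fromℤ-injective (begin
  fromℤ (+ suc k)            ≡⟨ sym (ℕ→ℚ≡fromℤ (suc k)) ⟩
  ℕ→ℚ (suc k)                ≡⟨ isolate y (ℕ→ℚ (suc k)) ⟩
  (y + ℕ→ℚ (suc k)) - y      ≡⟨ cong (_- y) eq ⟩
  y - y                      ≡⟨ ℚP.+-inverseʳ y ⟩
  fromℤ (+ 0)                ∎)))
  where
  open ≡-Reasoning
  isolate : ∀ y q → q ≡ (y + q) - y
  isolate = solve-∀ ℚ-ring

shifted-square : ∀ d S y → (d + S) * (d + S) ≡ d * d + y → (d + d + S) * S ≡ y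
shifted-square d S y eq = begin
  (d + d + S) * S                         ≡⟨ expand d S ⟩
  (d + S) * (d + S) - d * d               ≡⟨ cong (_- d * d) eq ⟩
  d * d + y - d * d                       ≡⟨ cancel d y ⟩
  y                                       ∎
  where
  open ≡-Reasoning
  expand : ∀ d S → (d + d + S) * S ≡ (d + S) * (d + S) - d * d
  expand = solve-∀ ℚ-ring
  cancel : ∀ d y → d * d + y - d * d ≡ y
  cancel = solve-∀ ℚ-ring

half-of-integer : ∀ m {d} → d + d ≡ fromℤ (+ m) → d ≡ (+ suc (suc m)) / 2 - 1ℚ
half-of-integer m {d} 2d≡m = double-injective (begin
  d + d                                       ≡⟨ 2d≡m ⟩
  fromℤ (+ m)                                 ≡⟨ sym (halves (fromℤ (+ m))) ⟩
  h (1ℚ + 1ℚ + fromℤ (+ m)) + h (1ℚ + 1ℚ + fromℤ (+ m))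
                                              ≡⟨ cong (λ t → h t + h t) (sym (fromℤ-+ (+ 2) (+ m))) ⟩
  h (fromℤ (+ suc (suc m))) + h (fromℤ (+ suc (suc m)))
                                              ≡⟨ cong (λ t → t - 1ℚ + (t - 1ℚ)) half-N ⟩
  (+ suc (suc m)) / 2 - 1ℚ + ((+ suc (suc m)) / 2 - 1ℚ) ∎)
  where
  open ≡-Reasoning
  h : ℚ → ℚ
  h M = M * (+ 1 / 2) - 1ℚ
  halves : ∀ M → (1ℚ + 1ℚ + M) * (+ 1 / 2) - 1ℚ + ((1ℚ + 1ℚ + M) * (+ 1 / 2) - 1ℚ) ≡ M
  halves = solve-∀ ℚ-ring
  half-N : fromℤ (+ suc (suc m)) * (+ 1 / 2) ≡ (+ suc (suc m)) / 2
  half-N = ℚP./-cong {p₁ = + suc (suc m) ℤ.* + 1} {q₁ = 2} {p₂ = + suc (suc m)} {q₂ = 2}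
             (ℤP.*-identityʳ (+ suc (suc m))) refl

centre-value : ∀ {m d S} → Prime (suc m) → ∃[ a ] fromℤ (+ a) ≡ d + d → IsInt S →
               (d + d + S) * S ≡ ℕ→ℚ (suc m) → d ≡ (+ suc (suc m)) / 2 - 1ℚ
centre-value {m} {d} p-prime (a , a≡2d) (s , refl) eq =
  half-of-integer m (trans (sym a≡2d) (cong (λ k → fromℤ (+ k)) a≡m))
  where
  open ≡-Reasoning
  a≡m : a ≡ m
  a≡m = root-lemma p-prime a s (fromℤ-injective (begin
    fromℤ ((+ a ℤ.+ s) ℤ.* s)              ≡⟨ fromℤ-* (+ a ℤ.+ s) s ⟩
    fromℤ (+ a ℤ.+ s) * fromℤ s            ≡⟨ cong (_* fromℤ s) (fromℤ-+ (+ a) s) ⟩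
    (fromℤ (+ a) + fromℤ s) * fromℤ s      ≡⟨ cong (λ t → (t + fromℤ s) * fromℤ s) a≡2d ⟩
    (d + d + fromℤ s) * fromℤ s            ≡⟨ eq ⟩
    ℕ→ℚ (suc m)                            ≡⟨ ℕ→ℚ≡fromℤ (suc m) ⟩
    fromℤ (+ suc m)                        ∎))

corollary3p4 : (n : ℕ) → 2 ≤ n → (d : ℚ) → 0ℚ ≤ℚ d → (c : Fin n → ℚ)
    → (∀ (z : Fin n) → toℕ z ≡ 0 → c z ≡ d)
    → (∀ (j : Fin n) → toℕ j ≢ 0 → (c j ≡ 1ℚ) ⊎ (c j ≡ - 1ℚ))
    → (∀ (i j : Fin n) → (circulant c · transpose (circulant c)) i j ≡ scale (d * d + ℕ→ℚ (n ∸ 1)) identity i j)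
    → Prime (n ∸ 1)
    → d ≡ (+ n / 2) - 1ℚ
corollary3p4 (suc (suc m)) (s≤s (s≤s z≤n)) d 0≤d c centre signs C·Cᵀ≡xI p-prime =
  centre-value p-prime (nonneg-int 2d-int 0≤2d) S-int (shifted-square d S _ T²≡x)
  where
  S : ℚ
  S = sum (c ∘ fsuc)
  c₀≡d : c fzero ≡ d
  c₀≡d = centre fzero refl
  sign : ∀ j → j ≢ fzero → IsSign (c j)
  sign j j≢0 = signs j (j≢0 ∘ FinP.toℕ-injective)
  S-int : IsInt S
  S-int = sum-int (c ∘ fsuc) (λ k → sign-int (sign (fsuc k) λ ()))
  T²≡x : (d + S) * (d + S) ≡ d * d + ℕ→ℚ (suc m)
  T²≡x = subst (λ t → (t + S) * (t + S) ≡ d * d + ℕ→ℚ (suc m)) c₀≡d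
           (generator-sum-squared c _ C·Cᵀ≡xI)
  2d-int : IsInt (d + d)
  2d-int = subst (λ t → IsInt (t + t)) c₀≡d (twice-centre-int c _ sign C·Cᵀ≡xI
             (subst (λ t → d * d + ℕ→ℚ (suc m) ≢ t * t) (sym c₀≡d) (shift-≢ (d * d) m)))
  0≤2d : 0ℚ ≤ℚ d + d
  0≤2d = subst (_≤ℚ d + d) (ℚP.+-identityʳ 0ℚ) (ℚP.+-mono-≤ 0≤d 0≤d)
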